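{- Let $\mathcal{T}$ be a single-elimination tournament, $\sigma$ a scoring system, $u\in V(\mathcal{T})$, $\mathcal{B}=\{B_1,\dots,B_r\}$ a set of brackets of $\mathcal{T}$, and $\widetilde{B}_i$ the restriction of $B_i$ to $V(\mathcal{T}_u)$. Suppose: (a) $\{\widetilde{B}_1,\dots,\widetilde{B}_r\}$ is a $\sigma_u$-resolving set for $\mathcal{T}_u$; (b) $B_i(x)\notin P(u)$ for all $i$ and all $x\in M(\mathcal{T})\setminus V(\mathcal{T}_u)$; and (c) for every pair of brackets $B,B'$ of $\mathcal{T}$ with $\mathrm{score}_\sigma(B_i,B)=\mathrm{score}_\sigma(B_i,B')$ for all $i$, we have for all $a\in P(\mathcal{T})\setminus P(u)$ and every $x\in M(\mathcal{T})$ that $B(x)=a$ if and only if $B'(x)=a$. Then $\mathcal{B}$ is a $\sigma$-resolving set for $\mathcal{T}$.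
   Context: For a digraph, $N^+(v)$ is the set of out-neighbours of $v$ and $N^-(v)$ the set of in-neighbours; a sink has $N^+(v)=\emptyset$, a source has $N^-(v)=\emptyset$. A single-elimination tournament $\mathcal{T}$ is a finite digraph with: exactly one sink; $|N^+(v)|=1$ for every non-sink $v$; no directed cycles; and $|N^-(v)|\ne 1$ for every vertex $v$. Players $P(\mathcal{T})$ are the sources; matches $M(\mathcal{T})$ are the non-sources. A directed walk from $u_1$ to $u_t$ is a sequence $(u_1,\dots,u_t)$, $t\ge1$, with $u_{i+1}\in N^+(u_i)$; the player set $P(u)$ of a vertex $u$ is the set of players $a$ with a directed walk from $a$ to $u$. A bracket is a function $B:V(\mathcal{T})\to P(\mathcal{T})$ with $B(a)=a$ for every player $a$ and $B(x)\in\{B(v):v\in N^-(x)\}$ for every match $x$. A scoring system is a function $\sigma:M(\mathcal{T})\to\mathbb{R}_{>0}$; $\mathrm{score}_\sigma(B,B')=\sum_{x\in M(\mathcal{T}):B(x)=B'(x)}\sigma(x)$. A set of brackets $\mathcal{B}$ is $\sigma$-resolving if for all pairs of distinct brackets $B,B'$ there is $B_i\in\mathcal{B}$ with $\mathrm{score}_\sigma(B_i,B)\ne\mathrm{score}_\sigma(B_i,B')$. For $u\in V(\mathcal{T})$, $\mathcal{T}_u$ is the digraph obtained from $\mathcal{T}$ by deleting every vertex $v$ with $P(v)\not\subseteq P(u)$; it is a single-elimination tournament with sink $u$ whose in-neighbourhoods agree with those in $\mathcal{T}$ and whose matches are $M(\mathcal{T})\cap V(\mathcal{T}_u)$; $\sigma_u$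 is the restriction of $\sigma$ to $M(\mathcal{T})\cap V(\mathcal{T}_u)$, a scoring system on $\mathcal{T}_u$. -}

module Defs where

open import Level using (_⊔_) renaming (suc to lsuc)
open import Data.Nat using (ℕ; zero; suc)
open import Data.Fin using (Fin; zero; suc; _≟_)
open import Data.Fin.Properties using (all?)
open import Data.Bool using (Bool; true; false; T; _∧_; if_then_else_)
import Data.Bool as Bool
open import Data.Product using (Σ; _×_; _,_; ∃)
open import Relation.Nullary using (¬_; Dec)
open import Relation.Nullary.Decidable using (⌊_⌋; ¬?; T?; _→-dec_)
open import Relation.Binary.PropositionalEquality using (_≡_)
open import Relation.Binary.Core using (Rel)
open import Relation.Binary.Structures using (IsStrictTotalOrder)
open import Algebra.Bundles using (CommutativeRing)

ExactlyOne : ∀ {n} → (Fin n → Set) → Set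
ExactlyOne P = Σ _ λ w → P w × (∀ w' → P w' → w' ≡ w)

-- A totally ordered commutative ring: the abstract stand-in for ℝ
-- (agda-stdlib has no real numbers).
record OrderedCommutativeRing c ℓ₁ ℓ₂ : Set (lsuc (c ⊔ ℓ₁ ⊔ ℓ₂)) where
  field
    commutativeRing : CommutativeRing c ℓ₁
  open CommutativeRing commutativeRing public
  field
    _<_                : Rel Carrier ℓ₂
    isStrictTotalOrder : IsStrictTotalOrder _≈_ _<_
    +-monoˡ-<          : ∀ {x y} z → x < y → (x + z) < (y + z)
    *-pos              : ∀ {x y} → 0# < x → 0# < y → 0# < (x * y)

module Digraph {n : ℕ} (Arc : Fin n → Fin n → Bool) where

  infix 4 _⟶_
  _⟶_ : Fin n → Fin n → Set
  v ⟶ w = Arc v w ≡ true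

  IsSink : Fin n → Set
  IsSink v = ∀ w → ¬ (v ⟶ w)

  IsSource : Fin n → Set
  IsSource v = ∀ w → ¬ (w ⟶ v)

  data Walk : Fin n → Fin n → Set where
    []  : ∀ {v} → Walk v v
    _∷_ : ∀ {u w v} → u ⟶ w → Walk w v → Walk u v

  record IsSingleElimination : Set where
    field
      uniqueSink   : ExactlyOne IsSink
      outDegOne    : ∀ v → ¬ IsSink v → ExactlyOne (v ⟶_)
      acyclic      : ∀ v w → v ⟶ w → ¬ Walk w v
      inDegNotOne  : ∀ v → ¬ ExactlyOne (_⟶ v)

  IsPlayer : Fin n → Set
  IsPlayer = IsSource

  IsMatch : Fin n → Set
  IsMatch v = ¬ IsPlayer v

  _∈P_ : Fin n → Fin n → Set
  a ∈P u = IsPlayer a × Walk a u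

  -- P(v) ⊆ P(u), i.e. v ∈ V(𝒯_u)
  _⊆P_ : Fin n → Fin n → Set
  v ⊆P u = ∀ a → a ∈P v → a ∈P u

  -- Notions for the subdigraph induced on a vertex set S (S : Fin n → Bool).
  -- With S = all, this is 𝒯 itself; with S = V(𝒯_u), it is 𝒯_u.
  -- A bracket of the induced subdigraph is a function Fin n → Fin n of which
  -- only the values on S matter.

  In : (Fin n → Bool) → Fin n → Set
  In S v = T (S v)

  all : Fin n → Bool
  all _ = true

  PlayerIn : (Fin n → Bool) → Fin n → Set
  PlayerIn S v = ∀ w → In S w → ¬ (w ⟶ v)

  MatchIn : (Fin n → Bool) → Fin n → Set
  MatchIn S v = ¬ PlayerIn S v

  playerIn? : (S : Fin n → Bool) → ∀ v → Dec (PlayerIn S v)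
  playerIn? S v = all? λ w → T? (S w) →-dec ¬? (Arc w v Bool.≟ true)

  record IsBracketOn (S : Fin n → Bool) (B : Fin n → Fin n) : Set where
    field
      inPlayers : ∀ v → In S v → In S (B v) × PlayerIn S (B v)
      onPlayers : ∀ a → In S a → PlayerIn S a → B a ≡ a
      onMatches : ∀ x → In S x → MatchIn S x →
                  Σ (Fin n) λ w → In S w × (w ⟶ x) × (B w ≡ B x)

  IsBracket : (Fin n → Fin n) → Set
  IsBracket = IsBracketOn all

  SameOn : (Fin n → Bool) → (Fin n → Fin n) → (Fin n → Fin n) → Set
  SameOn S B B' = ∀ v → In S v → B v ≡ B' v

  module Scoring {c ℓ : _} (R : CommutativeRing c ℓ) where
    open CommutativeRing R using (Carrier; _≈_; _+_; 0#)

    sumFin : ∀ {m} → (Fin m → Carrier) → Carrier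
    sumFin {zero}  f = 0#
    sumFin {suc m} f = f zero + sumFin (λ i → f (suc i))

    score : (σ : Fin n → Carrier) (S : Fin n → Bool) →
            (Fin n → Fin n) → (Fin n → Fin n) → Carrier
    score σ S B B' = sumFin λ x →
      if S x ∧ ⌊ ¬? (playerIn? S x) ⌋ ∧ ⌊ B x ≟ B' x ⌋ then σ x else 0#

    IsResolving : (σ : Fin n → Carrier) (S : Fin n → Bool) →
                  ∀ {r} → (Fin r → Fin n → Fin n) → Set (ℓ)
    IsResolving σ S {r} Bs =
      ∀ B B' → IsBracketOn S B → IsBracketOn S B' → ¬ SameOn S B B' →
      ∃ λ (i : Fin r) → ¬ (score σ S (Bs i) B ≈ score σ S (Bs i) B')

{-# OPTIONS --safe #-}

-- The score of a bracket against Bᵢ splits into the part earned on the matches of 𝒯_u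
-- and the part earned on the remaining matches x. There Bᵢ(x) ∉ P(u) by (b), so by (c)
-- two brackets B, B′ with equal scores against every Bᵢ predict Bᵢ(x) at exactly the same
-- such x: their outer parts coincide, hence so do their scores on 𝒯_u, and by (a) B and B′
-- agree on 𝒯_u. At a match x outside 𝒯_u, (c) also gives B(x) = B′(x) unless both winners
-- lie in P(u); but then u lies on the path from each winner to x, along which a bracket is
-- constant, so B(x) = B(u) = B′(u) = B′(x).
module Submission where

open import Defs
open import Data.Nat using (ℕ; zero; suc)
open import Data.Fin using (Fin; zero; suc; _≟_)
open import Data.Fin.Induction using (spo-wellFounded)
open import Data.Fin.Properties using (¬∀⟶∃¬)
open import Data.Bool using (Bool; true; false; T; not; _∧_; if_then_else_)
open import Data.Unit using (tt)
open import Data.Empty using (⊥; ⊥-elim)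
open import Data.Sum using (inj₁; inj₂; _⊎_)
open import Data.Product using (Σ; _×_; _,_; proj₂)
open import Function.Base using (_∘_)
open import Function.Bundles using (_⇔_; mk⇔; Equivalence)
open import Function.Related.TypeIsomorphisms using (¬-cong-⇔)
open import Relation.Nullary using (¬_; Dec; yes; no)
open import Relation.Nullary.Decidable using (⌊_⌋; ¬?; T?; does-⇔; isYes≗does; decidable-stable)
open import Relation.Binary.PropositionalEquality as ≡ using (_≡_; refl; cong; subst; isEquivalence)
open import Relation.Binary.Structures using (IsStrictTotalOrder)
open import Induction.WellFounded using (WellFounded; Acc; acc)
open import Algebra.Bundles using (CommutativeRing)
import Algebra.Properties.Group as GroupProperties
import Algebra.Properties.CommutativeMonoid.Sum as Sum
import Relation.Binary.Reasoning.Setoid as SetoidReasoning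

open Equivalence using (to; from)

⌊⌋-⇔ : ∀ {A B : Set} → A ⇔ B → (a? : Dec A) (b? : Dec B) → ⌊ a? ⌋ ≡ ⌊ b? ⌋
⌊⌋-⇔ A⇔B a? b? =
  ≡.trans (isYes≗does a?) (≡.trans (does-⇔ A⇔B a? b?) (≡.sym (isYes≗does b?)))

module Tournament {n : ℕ} (Arc : Fin n → Fin n → Bool) where
  open Digraph Arc

  infixl 5 _∷ʳ_
  infixr 5 _++_

  _∷ʳ_ : ∀ {a w x} → Walk a w → w ⟶ x → Walk a x
  [] ∷ʳ e = e ∷ []
  (e′ ∷ W) ∷ʳ e = e′ ∷ (W ∷ʳ e)

  _++_ : ∀ {a b c} → Walk a b → Walk b c → Walk a c
  [] ++ V = V
  (e ∷ W) ++ V = e ∷ (W ++ V)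

  walk⇒⊆P : ∀ {v w} → Walk v w → v ⊆P w
  walk⇒⊆P W a (player , V) = player , V ++ W

  _⟶⁺_ : Fin n → Fin n → Set
  w ⟶⁺ v = Σ _ λ z → w ⟶ z × Walk z v

  InClosed : (Fin n → Bool) → Set
  InClosed S = ∀ {w x} → w ⟶ x → In S x → In S w

  walk-closed : ∀ {S} → InClosed S → ∀ {w x} → Walk w x → In S x → In S w
  walk-closed closed []      x∈S = x∈S
  walk-closed closed (e ∷ W) x∈S = closed e (walk-closed closed W x∈S)

  ⊆P-closed : ∀ {S u} → (∀ v → In S v ⇔ v ⊆P u) → InClosed S
  ⊆P-closed S⇔ {w} {x} e x∈S =
    from (S⇔ w) λ a a∈w → to (S⇔ x) x∈S a (walk⇒⊆P (e ∷ []) a a∈w)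

  player⇒playerIn-all : ∀ {v} → IsPlayer v → PlayerIn all v
  player⇒playerIn-all player w _ = player w

  playerIn-closed : ∀ {S} → InClosed S → ∀ {x} → In S x → PlayerIn S x → PlayerIn all x
  playerIn-closed closed x∈S player w _ e = player w (closed e x∈S) e

  module SingleElimination (se : IsSingleElimination) where
    open IsSingleElimination se

    ⟶-functional : ∀ {a b c} → a ⟶ b → a ⟶ c → b ≡ c
    ⟶-functional {a} e e′ with outDegOne a (λ sink → sink _ e)
    ... | _ , _ , unique = ≡.trans (unique _ e) (≡.sym (unique _ e′))

    penultimate-unique : ∀ {a y w x} → Walk a y → Walk a w → y ⟶ x → w ⟶ x → y ≡ w
    penultimate-unique []      []        _  _  = refl
    penultimate-unique []      (e ∷ W)   e₁ e₂ with refl ← ⟶-functional e₁ e =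
      ⊥-elim (acyclic _ _ e₂ W)
    penultimate-unique (e ∷ W) []        e₁ e₂ with refl ← ⟶-functional e₂ e =
      ⊥-elim (acyclic _ _ e₁ W)
    penultimate-unique (e ∷ W) (e′ ∷ W′) e₁ e₂ with refl ← ⟶-functional e e′ =
      penultimate-unique W W′ e₁ e₂

    walks-comparable : ∀ {a v w} → Walk a v → Walk a w → Walk v w ⊎ Walk w v
    walks-comparable []      W         = inj₁ W
    walks-comparable (e ∷ W) []        = inj₂ (e ∷ W)
    walks-comparable (e ∷ W) (e′ ∷ W′) with refl ← ⟶-functional e e′ = walks-comparable W W′

    ⟶⁺-wellFounded : WellFounded _⟶⁺_
    ⟶⁺-wellFounded = spo-wellFounded record
      { isEquivalence = isEquivalence
      ; irrefl        = λ { refl (_ , e , W) → acyclic _ _ e W }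
      ; trans         = λ { (_ , e , W) (_ , e′ , W′) → _ , e , W ++ e′ ∷ W′ }
      ; <-resp-≈      = (λ { refl p → p }) , (λ { refl p → p })
      }

    module _ {B : Fin n → Fin n} (bB : IsBracket B) where
      open IsBracketOn bB

      winner-isPlayer : ∀ v → IsPlayer (B v)
      winner-isPlayer v w = proj₂ (inPlayers v tt) w tt

      winner-reaches : ∀ v → Walk (B v) v
      winner-reaches v = go v (⟶⁺-wellFounded v)
        where
        go : ∀ v → Acc _⟶⁺_ v → Walk (B v) v
        go v (acc rec) with playerIn? all v
        ... | yes player rewrite onPlayers v tt player = []
        ... | no match with onMatches v tt match
        ...   | w , _ , e , Bw≡Bv = subst (λ b → Walk b v) Bw≡Bv (go w (rec (v , e , [])) ∷ʳ e)

      winner-constant : ∀ {v y} → Walk (B v) y → Walk y v → B y ≡ B v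
      winner-constant W [] = refl
      winner-constant {v} {y} W (e ∷ V) with onMatches _ tt (λ player → player y tt e)
      ... | w , _ , e′ , Bw≡Bz = ≡.trans (cong B y≡w) Bw≡Bv
        where
        Bw≡Bv : B w ≡ B v
        Bw≡Bv = ≡.trans Bw≡Bz (winner-constant (W ∷ʳ e) V)
        y≡w : y ≡ w
        y≡w = penultimate-unique W (subst (λ b → Walk b w) Bw≡Bv (winner-reaches w)) e e′

      winner-at-descendant : ∀ {u v} → Walk (B v) u → ¬ (v ⊆P u) → B u ≡ B v
      winner-at-descendant W v⊈u with walks-comparable W (winner-reaches _)
      ... | inj₁ u↝v = winner-constant W u↝v
      ... | inj₂ v↝u = ⊥-elim (v⊈u (walk⇒⊆P v↝u))

      restrict : ∀ {S} → InClosed S → IsBracketOn S B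
      restrict closed = record
        { inPlayers = λ v v∈S → walk-closed closed (winner-reaches v) v∈S , λ w _ → winner-isPlayer v w
        ; onPlayers = λ a a∈S player → onPlayers a tt (playerIn-closed closed a∈S player)
        ; onMatches = λ x x∈S match →
            let (w , _ , e , Bw≡Bx) = onMatches x tt (λ player → match (λ w _ → player w tt))
            in w , closed e x∈S , e , Bw≡Bx
        }

    sameOn-extend : ∀ {B B′ S u} → IsBracket B → IsBracket B′ → (∀ v → In S v ⇔ v ⊆P u) →
                    SameOn S B B′ →
                    (∀ a → IsPlayer a → ¬ (a ∈P u) → ∀ x → IsMatch x → (B x ≡ a ⇔ B′ x ≡ a)) →
                    SameOn all B B′
    sameOn-extend {B} {B′} {S} {u} bB bB′ S⇔ same agree v _ =
      decidable-stable (B v ≟ B′ v) ¬¬same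
      where
      ¬¬same : ¬ ¬ (B v ≡ B′ v)
      ¬¬same B≢B′ with T? (S v) | playerIn? all v
      ... | yes v∈S | _ = B≢B′ (same v v∈S)
      ... | no _ | yes player =
        B≢B′ (≡.trans (IsBracketOn.onPlayers bB v tt player)
                      (≡.sym (IsBracketOn.onPlayers bB′ v tt player)))
      ... | no v∉S | no ¬player = Bv∈u λ (_ , Bv↝u) → B′v∈u λ (_ , B′v↝u) → B≢B′ (begin
          B v   ≡⟨ winner-at-descendant bB Bv↝u v⊈u ⟨
          B u   ≡⟨ same u (from (S⇔ u) λ _ a∈u → a∈u) ⟩
          B′ u  ≡⟨ winner-at-descendant bB′ B′v↝u v⊈u ⟩
          B′ v  ∎)
        where
        open ≡.≡-Reasoning
        match : IsMatch v
        match = ¬player ∘ player⇒playerIn-all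
        v⊈u : ¬ (v ⊆P u)
        v⊈u = v∉S ∘ from (S⇔ v)
        Bv∈u : ¬ ¬ (B v ∈P u)
        Bv∈u Bv∉u = B≢B′ (≡.sym (to (agree (B v) (winner-isPlayer bB v) Bv∉u v match) refl))
        B′v∈u : ¬ ¬ (B′ v ∈P u)
        B′v∈u B′v∉u = B≢B′ (from (agree (B′ v) (winner-isPlayer bB′ v) B′v∉u v match) refl)

module ScoreSplit {c ℓ} (R : CommutativeRing c ℓ) {n : ℕ} (Arc : Fin n → Fin n → Bool) where
  open CommutativeRing R
    using (Carrier; _≈_; _+_; 0#; setoid; sym; reflexive; +-identityˡ; +-identityʳ; +-congˡ; +-group; +-commutativeMonoid)
  open Digraph Arc
  open Scoring R
  open Tournament Arc using (InClosed; player⇒playerIn-all; playerIn-closed)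
  open Sum +-commutativeMonoid using (sum; ∑-distrib-+; sum-cong-≋)
  open SetoidReasoning setoid

  sumFin≡sum : ∀ {m} (f : Fin m → Carrier) → sumFin f ≡ sum f
  sumFin≡sum {zero}  f = ≡.refl
  sumFin≡sum {suc m} f = cong (f zero +_) (sumFin≡sum (f ∘ suc))

  sumFin-cong : ∀ {m} {f g : Fin m → Carrier} → (∀ i → f i ≈ g i) → sumFin f ≈ sumFin g
  sumFin-cong {f = f} {g} f≈g = begin
    sumFin f  ≡⟨ sumFin≡sum f ⟩
    sum f     ≈⟨ sum-cong-≋ f≈g ⟩
    sum g     ≡⟨ sumFin≡sum g ⟨
    sumFin g  ∎

  sumFin-distrib-+ : ∀ {m} (f g : Fin m → Carrier) →
                     sumFin (λ i → f i + g i) ≈ sumFin f + sumFin g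
  sumFin-distrib-+ f g = begin
    sumFin (λ i → f i + g i)  ≡⟨ sumFin≡sum (λ i → f i + g i) ⟩
    sum (λ i → f i + g i)     ≈⟨ ∑-distrib-+ f g ⟩
    sum f + sum g             ≡⟨ ≡.cong₂ _+_ (sumFin≡sum f) (sumFin≡sum g) ⟨
    sumFin f + sumFin g       ∎

  scoreOutside : (σ : Fin n → Carrier) (S : Fin n → Bool) →
                 (Fin n → Fin n) → (Fin n → Fin n) → Carrier
  scoreOutside σ S A B = sumFin λ x →
    if not (S x) ∧ ⌊ ¬? (playerIn? all x) ⌋ ∧ ⌊ A x ≟ B x ⌋ then σ x else 0#

  if-split : ∀ s {p q} d (w : Carrier) → (T s → p ≡ q) →
             (if p ∧ d then w else 0#) ≈
             (if s ∧ q ∧ d then w else 0#) + (if not s ∧ p ∧ d then w else 0#)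
  if-split true  d w p≡q rewrite p≡q tt = sym (+-identityʳ _)
  if-split false d w _                  = sym (+-identityˡ _)

  score-split : ∀ σ {S} → InClosed S → ∀ A B →
                score σ all A B ≈ score σ S A B + scoreOutside σ S A B
  score-split σ {S} closed A B = begin
    score σ all A B                       ≈⟨ sumFin-cong split ⟩
    sumFin (λ x → inside x + outside x)   ≈⟨ sumFin-distrib-+ inside outside ⟩
    score σ S A B + scoreOutside σ S A B  ∎
    where
    agrees : Fin n → Bool
    agrees x = ⌊ A x ≟ B x ⌋
    inside outside : Fin n → Carrier
    inside  x = if S x ∧ ⌊ ¬? (playerIn? S x) ⌋ ∧ agrees x then σ x else 0#
    outside x = if not (S x) ∧ ⌊ ¬? (playerIn? all x) ⌋ ∧ agrees x then σ x else 0#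
    split : ∀ x → (if ⌊ ¬? (playerIn? all x) ⌋ ∧ agrees x then σ x else 0#) ≈ inside x + outside x
    split x = if-split (S x) (agrees x) (σ x) λ x∈S →
      ⌊⌋-⇔ (¬-cong-⇔ (mk⇔ (λ player w _ → player w tt) (playerIn-closed closed x∈S))) _ _

  scoreOutside-cong : ∀ σ S {A B B′} →
                      (∀ x → IsMatch x → ¬ In S x → (B x ≡ A x ⇔ B′ x ≡ A x)) →
                      scoreOutside σ S A B ≈ scoreOutside σ S A B′
  scoreOutside-cong σ S {A} {B} {B′} agree = sumFin-cong (reflexive ∘ summand-cong)
    where
    summand-cong : ∀ x →
      (if not (S x) ∧ ⌊ ¬? (playerIn? all x) ⌋ ∧ ⌊ A x ≟ B x ⌋ then σ x else 0#) ≡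
      (if not (S x) ∧ ⌊ ¬? (playerIn? all x) ⌋ ∧ ⌊ A x ≟ B′ x ⌋ then σ x else 0#)
    summand-cong x with S x in Sx≡false | playerIn? all x
    ... | true  | _          = ≡.refl
    ... | false | yes _      = ≡.refl
    ... | false | no ¬player = cong (λ b → if b then σ x else 0#) (⌊⌋-⇔ A≡B⇔A≡B′ _ _)
      where
      B⇔B′ : B x ≡ A x ⇔ B′ x ≡ A x
      B⇔B′ = agree x (¬player ∘ player⇒playerIn-all) (subst T Sx≡false)
      A≡B⇔A≡B′ : A x ≡ B x ⇔ A x ≡ B′ x
      A≡B⇔A≡B′ = mk⇔ (≡.sym ∘ to B⇔B′ ∘ ≡.sym) (≡.sym ∘ from B⇔B′ ∘ ≡.sym)

  score-restrict-cong : ∀ σ {S} → InClosed S → ∀ {A B B′} →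
                        score σ all A B ≈ score σ all A B′ →
                        (∀ x → IsMatch x → ¬ In S x → (B x ≡ A x ⇔ B′ x ≡ A x)) →
                        score σ S A B ≈ score σ S A B′
  score-restrict-cong σ {S} closed {A} {B} {B′} equal agree =
    GroupProperties.∙-cancelʳ +-group (scoreOutside σ S A B) _ _ (begin
      score σ S A B + scoreOutside σ S A B    ≈⟨ score-split σ closed A B ⟨
      score σ all A B                         ≈⟨ equal ⟩
      score σ all A B′                        ≈⟨ score-split σ closed A B′ ⟩
      score σ S A B′ + scoreOutside σ S A B′  ≈⟨ +-congˡ (scoreOutside-cong σ S agree) ⟨
      score σ S A B′ + scoreOutside σ S A B   ∎)

proposition5p4 :
  ∀ {c ℓ₁ ℓ₂} (ℝ : OrderedCommutativeRing c ℓ₁ ℓ₂) {n : ℕ}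
    (Arc : Fin n → Fin n → Bool) →
  let open OrderedCommutativeRing ℝ
      open Digraph Arc
      open Scoring commutativeRing
  in
  IsSingleElimination →
  (σ : Fin n → Carrier) → (∀ x → IsMatch x → 0# < σ x) →
  (u : Fin n) →
  -- Tu is the vertex set of 𝒯_u
  (Tu : Fin n → Bool) → (∀ v → T (Tu v) ⇔ (v ⊆P u)) →
  ∀ {r} (Bs : Fin r → Fin n → Fin n) → (∀ i → IsBracket (Bs i)) →
  -- (a)
  IsResolving σ Tu Bs →
  -- (b)
  (∀ i x → IsMatch x → ¬ T (Tu x) → ¬ (Bs i x ∈P u)) →
  -- (c)
  (∀ B B' → IsBracket B → IsBracket B' →
     (∀ i → score σ all (Bs i) B ≈ score σ all (Bs i) B') →
     ∀ a → IsPlayer a → ¬ (a ∈P u) →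
     ∀ x → IsMatch x → (B x ≡ a ⇔ B' x ≡ a)) →
  IsResolving σ all Bs
proposition5p4 ℝ Arc se σ _ u Tu Tu⇔ Bs bBs resolvingTu outsideWinners equal⇒agree
               B B′ bB bB′ B≢B′ =
  ¬∀⟶∃¬ _ _ (λ i → IsStrictTotalOrder._≟_ isStrictTotalOrder _ _) equal-scores⇒⊥
  where
  open OrderedCommutativeRing ℝ using (isStrictTotalOrder; commutativeRing; _≈_)
  open Digraph Arc
  open Scoring commutativeRing
  open Tournament Arc
  open SingleElimination se
  open ScoreSplit commutativeRing Arc

  Tu-closed : InClosed Tu
  Tu-closed = ⊆P-closed Tu⇔

  equal-scores⇒⊥ : (∀ i → score σ all (Bs i) B ≈ score σ all (Bs i) B′) → ⊥
  equal-scores⇒⊥ equal =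
    let (i , scoresDiffer) = resolvingTu B B′ (restrict bB Tu-closed) (restrict bB′ Tu-closed)
                               λ sameOnTu → B≢B′ (sameOn-extend bB bB′ Tu⇔ sameOnTu agree)
    in scoresDiffer (score-restrict-cong σ Tu-closed (equal i) λ x match x∉Tu →
         agree (Bs i x) (winner-isPlayer (bBs i) x) (outsideWinners i x match x∉Tu) x match)
    where
    agree : ∀ a → IsPlayer a → ¬ (a ∈P u) → ∀ x → IsMatch x → (B x ≡ a ⇔ B′ x ≡ a)
    agree = equal⇒agree B B′ bB bB′ equal
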